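{- Let $\psi:\mathcal{M}\to\mathcal{RW}$ be a map such that $m(\psi(\boldsymbol{p}))=m(\boldsymbol{p})$ for all $\boldsymbol{p}\in\mathcal{M}$ and, for all $u,v\in S_\mathbb{Z}$, the linear extension of $\psi$ sends $\mathbf{Sch}(u)\mathbf{Sch}(v)$ to $\sum_w\overleftarrow{c_{u,v}^w}\mathbf{Sch}(w)$. Then for any $\boldsymbol{p} \in \mathcal{M}$ and all $i$, \[ I_i(\boldsymbol{p}) = I_i(\psi(\boldsymbol{p})). \] Furthermore, \[ \mathrm{IncSuf}(m(\boldsymbol{p})) = \mathrm{IncSuf}(\psi(\boldsymbol{p})). \]
   Context: Colored words are finite words over $\overline{\mathbb{Z}}=\{i^{[j]} : i\in\mathbb{Z}, j\in\mathbb{Z}_+\}$ (value $i$, color $j$), ordered by value then color; $\mathbb{Z}$ is identified with color-$1$ letters. The colored shuffle product is $\boldsymbol{p}\boldsymbol{q} = \boldsymbol{p} \sqcup\!\sqcup (\boldsymbol{q}\uparrow \operatorname{maxcol}(\boldsymbol{p}))$, with $\sqcup\!\sqcup$ the Eilenberg–Mac Lane shuffle product (sum of order-preserving interlacings) and colors of $\boldsymbol{q}$ shifted above those of $\boldsymbol{p}$. $\mathbf{Sch}(w)=\sum_{\boldsymbol{w}\in\mathcal{RW}(w)}\boldsymbol{w}$; $\mathcal{M}$ is the set of all colored shuffled words appearing in $\mathbf{Sch}(u)\mathbf{Sch}(v)$ for some $u,v\in S_\mathbb{Z}$, and $\mathcal{RW}$ is the set of all reduced words (in $\mathbb{Z}^*$)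 of all permutations. $\overleftarrow{c_{u,v}^w}$ are back-stable Schubert structure constants. The maximal bottom row $m(\boldsymbol{t})$ of $\boldsymbol{t}=(t_1,\dots,t_k)$: $m(\boldsymbol{t})_k=\mathrm{val}(t_k)$, and for $j<k$, $m(\boldsymbol{t})_j=m(\boldsymbol{t})_{j+1}$ if $t_j\ge t_{j+1}$, else $\min(\mathrm{val}(t_j),m(\boldsymbol{t})_{j+1}-1)$. $\mathrm{IncSuf}(\boldsymbol{p})$ is the longest strictly increasing suffix of $\boldsymbol{p}$, of length $I(\boldsymbol{p})$; $I_i(\boldsymbol{p})=I(\boldsymbol{p})$ if the value of the last entry of $\boldsymbol{p}$ is $\le i$, and $0$ otherwise. -}

module Defs where

open import Data.Bool using (Bool; true; false; if_then_else_; _∧_; _∨_; not)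
open import Data.Nat as ℕ using (ℕ; zero; suc; _⊔_; _∸_)
open import Data.Integer as ℤ using (ℤ; +_; -[1+_])
open import Data.List using (List; []; _∷_; _++_; map; concatMap; foldr; length; upTo; last; filter)
open import Data.List.Properties using (≡-dec)
open import Data.List.Membership.Propositional using (_∈_)
open import Data.List.Relation.Unary.Unique.Propositional using (Unique)
open import Data.Maybe as Maybe using (Maybe; just; nothing; maybe)
open import Data.Product using (Σ; _×_; _,_; proj₁; proj₂; ∃-syntax)
open import Relation.Nullary using (¬_)
open import Relation.Nullary.Decidable using (⌊_⌋)
open import Relation.Binary.PropositionalEquality using (_≡_)

-- Colored words.  A colored letter i^[j] is the pair (i , j) : ℤ × ℕ
-- (colors occurring are always ≥ 1); ℤ is identified with color 1.

ColLetter : Set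
ColLetter = ℤ × ℕ

ColWord : Set
ColWord = List ColLetter

val : ColLetter → ℤ
val = proj₁

col : ColLetter → ℕ
col = proj₂

ltC : ColLetter → ColLetter → Bool
ltC (i , j) (i' , j') = ⌊ i ℤ.<? i' ⌋ ∨ (⌊ i ℤ.≟ i' ⌋ ∧ ⌊ j ℕ.<? j' ⌋)

embed : List ℤ → ColWord
embed = map (λ i → i , 1)

-- for the nonempty word t ∷ ts returns (first entry of m, m)
bottomAux : ColLetter → List ColLetter → ℤ × List ℤ
bottomAux t [] = val t , (val t ∷ [])
bottomAux t (t' ∷ ts) =
  let r  = bottomAux t' ts
      h  = proj₁ r
      h' = if not (ltC t t') then h else (val t ℤ.⊓ (h ℤ.- ℤ.1ℤ))
  in h' , (h' ∷ proj₂ r)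

bottomRow : ColWord → List ℤ
bottomRow [] = []
bottomRow (t ∷ ts) = proj₂ (bottomAux t ts)

incSuf : {A : Set} → (A → A → Bool) → List A → List A
incSuf lt [] = []
incSuf lt (x ∷ []) = x ∷ []
incSuf lt (x ∷ y ∷ xs) =
  let s = incSuf lt (y ∷ xs) in
  if ⌊ length s ℕ.≟ length (y ∷ xs) ⌋ ∧ lt x y then x ∷ y ∷ xs else s

ltZ : ℤ → ℤ → Bool
ltZ i j = ⌊ i ℤ.<? j ⌋

IncSufZ : List ℤ → List ℤ
IncSufZ = incSuf ltZ

IncSuf : ColWord → ColWord
IncSuf = incSuf ltC

I : ColWord → ℕ
I p = length (IncSuf p)

Ii : ℤ → ColWord → ℕ
Ii i p with last p
... | nothing = 0
... | just t  = if ⌊ val t ℤ.≤? i ⌋ then I p else 0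

-- S_ℤ : permutations given by words in the simple transpositions s_a,
-- a word a₁…aₗ denoting s_{a₁}⋯s_{aₗ} acting on ℤ.

sZ : ℤ → ℤ → ℤ
sZ a j = if ⌊ j ℤ.≟ a ⌋ then a ℤ.+ ℤ.1ℤ
         else if ⌊ j ℤ.≟ a ℤ.+ ℤ.1ℤ ⌋ then a else j

actZ : List ℤ → ℤ → ℤ
actZ [] j = j
actZ (a ∷ as) j = sZ a (actZ as j)

SamePerm : List ℤ → List ℤ → Set
SamePerm x y = ∀ j → actZ x j ≡ actZ y j

IsReducedWordOf : List ℤ → List ℤ → Set
IsReducedWordOf y x = SamePerm y x × (∀ z → SamePerm z x → length y ℕ.≤ length z)

IsReduced : List ℤ → Set
IsReduced y = IsReducedWordOf y y

-- L lists every reduced word of x exactly once, i.e. L is Sch(x)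
SchList : List ℤ → List (List ℤ) → Set
SchList x L = Unique L × (∀ y → y ∈ L → IsReducedWordOf y x)
                       × (∀ y → IsReducedWordOf y x → y ∈ L)

-- colored shuffle product of formal sums (formal sums = lists with
-- multiplicity)

maxcol : ColWord → ℕ
maxcol = foldr (λ t m → col t ⊔ m) 0

shiftCol : ℕ → ColWord → ColWord
shiftCol m = map (λ t → val t , col t ℕ.+ m)

shuffle : ColWord → ColWord → List ColWord
shuffle [] q = q ∷ []
shuffle (a ∷ p) [] = (a ∷ p) ∷ []
shuffle (a ∷ p) (b ∷ q) =
  map (a ∷_) (shuffle p (b ∷ q)) ++ map (b ∷_) (shuffle (a ∷ p) q)

colProdW : ColWord → ColWord → List ColWord
colProdW p q = shuffle p (shiftCol (maxcol p) q)

colProd : List ColWord → List ColWord → List ColWord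
colProd P Q = concatMap (λ p → concatMap (λ q → colProdW p q) Q) P

SchProd : List (List ℤ) → List (List ℤ) → List ColWord
SchProd Lu Lv = colProd (map embed Lu) (map embed Lv)

InM : ColWord → Set
InM p = ∃[ u ] ∃[ v ] ∃[ Lu ] ∃[ Lv ]
          (SchList u Lu × SchList v Lv × p ∈ SchProd Lu Lv)

-- Polynomials in x₁, x₂, … with ℤ coefficients: lists of terms
-- (c , α), α the exponent vector (α[0] = exponent of x₁).

Poly : Set
Poly = List (ℤ × List ℕ)

addExp : List ℕ → List ℕ → List ℕ
addExp [] β = β
addExp (a ∷ α) [] = a ∷ α
addExp (a ∷ α) (b ∷ β) = (a ℕ.+ b) ∷ addExp α β

getE : List ℕ → ℕ → ℕ
getE [] _ = 0
getE (a ∷ α) zero = a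
getE (a ∷ α) (suc j) = getE α j

setE : List ℕ → ℕ → ℕ → List ℕ
setE [] zero v = v ∷ []
setE [] (suc j) v = 0 ∷ setE [] j v
setE (a ∷ α) zero v = v ∷ α
setE (a ∷ α) (suc j) v = a ∷ setE α j v

consN : ℕ → List ℕ → List ℕ
consN zero [] = []
consN zero (b ∷ r) = 0 ∷ b ∷ r
consN (suc a) r = suc a ∷ r

normE : List ℕ → List ℕ
normE [] = []
normE (a ∷ α) = consN a (normE α)

coeff : Poly → List ℕ → ℤ
coeff [] β = ℤ.0ℤ
coeff ((c , α) ∷ p) β =
  (if ⌊ ≡-dec ℕ._≟_ (normE α) (normE β) ⌋ then c else ℤ.0ℤ) ℤ.+ coeff p β

_≐_ : Poly → Poly → Set
p ≐ q = ∀ β → coeff p β ≡ coeff q β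

mulP : Poly → Poly → Poly
mulP p q = concatMap (λ s → map (λ t → (proj₁ s ℤ.* proj₁ t) , addExp (proj₂ s) (proj₂ t)) q) p

-- divided difference ∂ on the variables x_{i+1}, x_{i+2} (0-based i)
ddTerm : ℕ → ℤ × List ℕ → Poly
ddTerm i (c , α) =
  let a = getE α i
      b = getE α (suc i)
  in if ⌊ b ℕ.<? a ⌋
     then map (λ k → c , setE (setE α i (a ∸ 1 ∸ k)) (suc i) (b ℕ.+ k)) (upTo (a ∸ b))
     else map (λ k → ℤ.- c , setE (setE α i (b ∸ 1 ∸ k)) (suc i) (a ℕ.+ k)) (upTo (b ∸ a))

dd : ℕ → Poly → Poly
dd i p = concatMap (ddTerm i) p

-- Permutations of {1,2,…} given by words over ℕ, letter a standing for
-- s_{a+1}; internally 1,2,… are relabelled 0,1,….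
sN : ℕ → ℕ → ℕ
sN a j = if ⌊ j ℕ.≟ a ⌋ then suc a else if ⌊ j ℕ.≟ suc a ⌋ then a else j

actN : List ℕ → ℕ → ℕ
actN [] j = j
actN (a ∷ as) j = sN a (actN as j)

oneLine : List ℕ → ℕ → List ℕ
oneLine w n = map (actN w) (upTo n)

maxL : List ℕ → ℕ
maxL = foldr _⊔_ 0

sizeOf : List ℕ → ℕ
sizeOf w = suc (suc (maxL w))

firstAscFrom : ℕ → List ℕ → Maybe ℕ
firstAscFrom k (x ∷ y ∷ r) = if ⌊ x ℕ.<? y ⌋ then just k else firstAscFrom (suc k) (y ∷ r)
firstAscFrom k _ = nothing

swapAt : ℕ → List ℕ → List ℕ
swapAt zero (x ∷ y ∷ r) = y ∷ x ∷ r
swapAt (suc k) (x ∷ r) = x ∷ swapAt k r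
swapAt _ r = r

-- b = b₁ … bₘ with v s_{b₁} ⋯ s_{bₘ} = w₀ and lengths increasing by one
toTop : ℕ → List ℕ → List ℕ
toTop zero v = []
toTop (suc f) v with firstAscFrom 0 v
... | nothing = []
... | just i  = i ∷ toTop f (swapAt i v)

delta : ℕ → List ℕ
delta n = map (λ j → n ∸ 1 ∸ j) (upTo n)

-- Schubert polynomial 𝔖_w = ∂_{b₁} ⋯ ∂_{bₘ} x^δ  (w, w₀ ∈ S_n)
schub : List ℕ → Poly
schub w = let n = sizeOf w in
  foldr dd ((ℤ.1ℤ , delta n) ∷ []) (toTop (n ℕ.* n) (oneLine w n))

samePermN : List ℕ → List ℕ → Bool
samePermN w y = let n = suc (suc (maxL w ⊔ maxL y)) in
  ⌊ ≡-dec ℕ._≟_ (oneLine w n) (oneLine y n) ⌋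

sumL : List (ℤ × List ℕ) → Poly
sumL L = concatMap (λ cw → map (λ t → (proj₁ cw ℤ.* proj₁ t) , proj₂ t) (schub (proj₂ cw))) L

shiftZ : ℕ → List ℤ → List ℤ
shiftZ k = map (λ i → i ℤ.+ + k)

pos : List ℤ → Maybe (List ℕ)
pos [] = just []
pos (+ zero ∷ r) = nothing
pos (+ suc a ∷ r) = Maybe.map (a ∷_) (pos r)
pos (-[1+ n ] ∷ r) = nothing

-- L is an expansion S_{γᵏu} S_{γᵏv} = Σ_{(c,w)∈L} c 𝔖_w in ordinary
-- Schubert polynomials (γᵏ = shift by k, requiring positivity)
OrdExp : ℕ → List ℤ → List ℤ → List (ℤ × List ℕ) → Set
OrdExp k u v L = ∃[ u' ] ∃[ v' ]
  (pos (shiftZ k u) ≡ just u' × pos (shiftZ k v) ≡ just v'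
   × (mulP (schub u') (schub v') ≐ sumL L))

matches : List ℕ → List ℤ → ℕ → Bool
matches w y k = maybe (λ y' → samePermN w y') false (pos (shiftZ k y))

coeffAt : List (ℤ × List ℕ) → List ℤ → ℕ → ℤ
coeffAt L y k = foldr (λ cw acc → (if matches (proj₂ cw) y k then proj₁ cw else ℤ.0ℤ) ℤ.+ acc) ℤ.0ℤ L

-- multiplicity of y in the linear extension of ψ applied to the formal sum P
count : (ColWord → List ℤ) → List ColWord → List ℤ → ℕ
count ψ P y = length (filter (λ p → ≡-dec ℤ._≟_ (ψ p) y) P)

-- linear extension of ψ sends Sch(u)Sch(v) to Σ_w c←^w_{u,v} Sch(w),
-- the back-stable constants being the stable values (k ≫ 0) of the
-- ordinary constants c^{γᵏw}_{γᵏu,γᵏv}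
LinHyp : (ColWord → List ℤ) → Set
LinHyp ψ = ∀ u v Lu Lv → SchList u Lu → SchList v Lv →
  ∃[ K ] (∀ k → K ℕ.≤ k → ∀ L → OrdExp k u v L →
    (∀ y → IsReduced y → + count ψ (SchProd Lu Lv) y ≡ coeffAt L y k)
    × (∀ y → ¬ IsReduced y → count ψ (SchProd Lu Lv) y ≡ 0))

{-# OPTIONS --safe #-}
-- The maximal bottom row m(t) is computed right to left, and its entry at
-- position j is below the next one exactly when t_j < t_{j+1}.  Hence m(t)
-- has the same ascents as t, and the increasing suffix of m(t) is the bottom
-- row of the increasing suffix of t; in particular I_i(t) can be read off
-- m(t).  On a strictly increasing word of color 1 the bottom row is the word
-- itself.  So for p ∈ 𝓜 everything is determined by m(p) = m(ψ(p)), and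
-- IncSuf(m(ψ(p))) = IncSuf(ψ(p)) because ψ(p) has color 1.
module Submission where

open import Defs
open import Data.Integer using (ℤ)
open import Data.List using (List)
open import Data.Product using (_×_)
open import Relation.Binary.PropositionalEquality using (_≡_)

open import Data.Bool using (Bool; true; false; T; if_then_else_; _∧_; _∨_; not)
open import Data.Bool.Properties using (if-float; T-∧; ∧-zeroʳ; ∨-identityʳ)
open import Data.Integer as ℤ using (_<_; _⊓_)
import Data.Integer.Properties as ℤ
open import Data.List using ([]; _∷_; length; last; map; head)
open import Data.List.Properties using (∷-injectiveˡ)
open import Data.List.Relation.Unary.Linked as Linked using (Linked; []; [-]; _∷_)
open import Data.Maybe as Maybe using (maybe; just; nothing)
open import Data.Nat as ℕ using (ℕ; suc; _≤_)
import Data.Nat.Properties as ℕ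
open import Data.Product using (_,_; proj₁; proj₂)
open import Function using (Equivalence)
open import Relation.Nullary using (¬_; contradiction)
open import Relation.Nullary.Decidable using (Dec; ⌊_⌋; toWitness; isYes≗does; dec-true; dec-false)
open import Relation.Binary.PropositionalEquality
  using (refl; sym; trans; cong; cong₂; subst; module ≡-Reasoning)
open ≡-Reasoning

⌊⌋-true : ∀ {P : Set} (d : Dec P) → P → ⌊ d ⌋ ≡ true
⌊⌋-true d p = trans (isYes≗does d) (dec-true d p)

⌊⌋-false : ∀ {P : Set} (d : Dec P) → ¬ P → ⌊ d ⌋ ≡ false
⌊⌋-false d ¬p = trans (isYes≗does d) (dec-false d ¬p)

module IncreasingSuffix {A : Set} (lt : A → A → Bool) where

  isFull : List A → Bool
  isFull xs = ⌊ length (incSuf lt xs) ℕ.≟ length xs ⌋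

  ascentTo : A → List A → Bool
  ascentTo x xs = maybe (lt x) true (head xs)

  incSuf-∷ : ∀ x xs → incSuf lt (x ∷ xs)
           ≡ (if isFull xs ∧ ascentTo x xs then x ∷ xs else incSuf lt xs)
  incSuf-∷ x []       = refl
  incSuf-∷ x (y ∷ xs) = refl

  length-incSuf-≤ : ∀ xs → length (incSuf lt xs) ≤ length xs
  length-incSuf-≤ []       = ℕ.z≤n
  length-incSuf-≤ (x ∷ xs) rewrite incSuf-∷ x xs with isFull xs ∧ ascentTo x xs
  ... | true  = ℕ.≤-refl
  ... | false = ℕ.m≤n⇒m≤1+n (length-incSuf-≤ xs)

  incSuf-full : ∀ xs → length (incSuf lt xs) ≡ length xs → incSuf lt xs ≡ xs
  incSuf-full []       _ = refl
  incSuf-full (x ∷ xs) full rewrite incSuf-∷ x xs with isFull xs ∧ ascentTo x xs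
  ... | true  = refl
  ... | false = contradiction (subst (_≤ length xs) full (length-incSuf-≤ xs)) ℕ.1+n≰n

  Ascending : List A → Set
  Ascending = Linked (λ x y → T (lt x y))

  ascending-∷ : ∀ {x} xs → T (ascentTo x xs) → Ascending xs → Ascending (x ∷ xs)
  ascending-∷ []       _   _   = [-]
  ascending-∷ (y ∷ ys) x<y asc = x<y ∷ asc

  incSuf-ascending : ∀ xs → Ascending (incSuf lt xs)
  incSuf-ascending []       = []
  incSuf-ascending (x ∷ xs) rewrite incSuf-∷ x xs
    with isFull xs ∧ ascentTo x xs in extends
  ... | false = incSuf-ascending xs
  ... | true  = ascending-∷ xs x<xs
                  (subst Ascending (incSuf-full xs (toWitness full)) (incSuf-ascending xs))
    where
    full×x<xs : T (isFull xs) × T (ascentTo x xs)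
    full×x<xs = Equivalence.to T-∧ (subst T (sym extends) _)
    full : T (isFull xs)
    full = proj₁ full×x<xs
    x<xs : T (ascentTo x xs)
    x<xs = proj₂ full×x<xs

open IncreasingSuffix using (isFull; ascentTo; incSuf-∷; incSuf-ascending)

module Scan {A B : Set} (ltA : A → A → Bool) (ltB : B → B → Bool)
         (g : List A → List B) (hd : A → List A → B)
         (g-[] : g [] ≡ [])
         (g-∷ : ∀ x xs → g (x ∷ xs) ≡ hd x xs ∷ g xs)
         (g-ascent : ∀ x xs → ascentTo ltB (hd x xs) (g xs) ≡ ascentTo ltA x xs)
         where

  length-scan : ∀ xs → length (g xs) ≡ length xs
  length-scan []       = cong length g-[]
  length-scan (x ∷ xs) = trans (cong length (g-∷ x xs)) (cong suc (length-scan xs))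

  incSuf-scan : ∀ xs → incSuf ltB (g xs) ≡ g (incSuf ltA xs)
  incSuf-scan []       = trans (cong (incSuf ltB) g-[]) (sym g-[])
  incSuf-scan (x ∷ xs) = begin
    incSuf ltB (g (x ∷ xs))
      ≡⟨ cong (incSuf ltB) (g-∷ x xs) ⟩
    incSuf ltB (hd x xs ∷ g xs)
      ≡⟨ incSuf-∷ ltB (hd x xs) (g xs) ⟩
    (if isFull ltB (g xs) ∧ ascentTo ltB (hd x xs) (g xs)
       then hd x xs ∷ g xs else incSuf ltB (g xs))
      ≡⟨ cong₂ (λ b r → if b then hd x xs ∷ g xs else r)
               (cong₂ _∧_ same-fullness (g-ascent x xs)) (incSuf-scan xs) ⟩
    (if isFull ltA xs ∧ ascentTo ltA x xs then hd x xs ∷ g xs else g (incSuf ltA xs))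
      ≡⟨ cong (λ l → if isFull ltA xs ∧ ascentTo ltA x xs then l else g (incSuf ltA xs))
              (sym (g-∷ x xs)) ⟩
    (if isFull ltA xs ∧ ascentTo ltA x xs then g (x ∷ xs) else g (incSuf ltA xs))
      ≡⟨ if-float g (isFull ltA xs ∧ ascentTo ltA x xs) ⟨
    g (if isFull ltA xs ∧ ascentTo ltA x xs then x ∷ xs else incSuf ltA xs)
      ≡⟨ cong g (incSuf-∷ ltA x xs) ⟨
    g (incSuf ltA (x ∷ xs)) ∎
    where
    same-fullness : isFull ltB (g xs) ≡ isFull ltA xs
    same-fullness = cong₂ (λ m n → ⌊ m ℕ.≟ n ⌋)
      (trans (cong length (incSuf-scan xs)) (length-scan (incSuf ltA xs)))
      (length-scan xs)

incSuf-map : ∀ {A B : Set} {ltA : A → A → Bool} {ltB : B → B → Bool} (f : A → B)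
           → (∀ x y → ltB (f x) (f y) ≡ ltA x y)
           → ∀ xs → incSuf ltB (map f xs) ≡ map f (incSuf ltA xs)
incSuf-map {ltA = ltA} {ltB} f f-ascent =
  Scan.incSuf-scan ltA ltB (map f) (λ x _ → f x) refl (λ _ _ → refl) ascent
  where
  ascent : ∀ x xs → ascentTo ltB (f x) (map f xs) ≡ ascentTo ltA x xs
  ascent x []      = refl
  ascent x (y ∷ _) = f-ascent x y

ltC-color1 : ∀ a b → ltC (a , 1) (b , 1) ≡ ltZ a b
ltC-color1 a b = trans (cong (ltZ a b ∨_) (∧-zeroʳ _)) (∨-identityʳ (ltZ a b))

ltZ-true : ∀ {a b} → a < b → ltZ a b ≡ true
ltZ-true {a} {b} = ⌊⌋-true (a ℤ.<? b)

-- bottomHead t (t' ∷ ts) unfolds to bottomStep (ltC t t') (val t) (bottomHead t' ts).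
bottomStep : Bool → ℤ → ℤ → ℤ
bottomStep ascent a h = if not ascent then h else a ⊓ (h ℤ.- ℤ.1ℤ)

bottomHead : ColLetter → ColWord → ℤ
bottomHead t ts = proj₁ (bottomAux t ts)

bottomRow-∷ : ∀ t ts → bottomRow (t ∷ ts) ≡ bottomHead t ts ∷ bottomRow ts
bottomRow-∷ t []        = refl
bottomRow-∷ t (t' ∷ ts) = refl

pred[i]≡i-1 : ∀ i → ℤ.pred i ≡ i ℤ.- ℤ.1ℤ
pred[i]≡i-1 i = ℤ.+-comm ℤ.-1ℤ i

ltZ-bottomStep : ∀ ascent a h → ltZ (bottomStep ascent a h) h ≡ ascent
ltZ-bottomStep false a h = ⌊⌋-false (h ℤ.<? h) (ℤ.<-irrefl refl)
ltZ-bottomStep true  a h = ltZ-true (ℤ.≤-<-trans (ℤ.i⊓j≤j a (h ℤ.- ℤ.1ℤ)) h-1<h)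
  where
  h-1<h : h ℤ.- ℤ.1ℤ < h
  h-1<h = ℤ.i≤pred[j]⇒i<j (ℤ.≤-reflexive (sym (pred[i]≡i-1 h)))

bottomStep-< : ∀ {a h} → a < h → bottomStep true a h ≡ a
bottomStep-< {a} {h} a<h = ℤ.i≤j⇒i⊓j≡i (subst (a ℤ.≤_) (pred[i]≡i-1 h) (ℤ.i<j⇒i≤pred[j] a<h))

bottomRow-ascent : ∀ t ts → ascentTo ltZ (bottomHead t ts) (bottomRow ts) ≡ ascentTo ltC t ts
bottomRow-ascent t []        = refl
bottomRow-ascent t (t' ∷ ts) rewrite bottomRow-∷ t' ts =
  ltZ-bottomStep (ltC t t') (val t) (bottomHead t' ts)

module BottomRow = Scan ltC ltZ bottomRow bottomHead refl bottomRow-∷ bottomRow-ascent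

incSuf-bottomRow : ∀ q → IncSufZ (bottomRow q) ≡ bottomRow (IncSuf q)
incSuf-bottomRow = BottomRow.incSuf-scan

length-incSuf-bottomRow : ∀ q → length (IncSufZ (bottomRow q)) ≡ I q
length-incSuf-bottomRow q =
  trans (cong length (incSuf-bottomRow q)) (BottomRow.length-scan (IncSuf q))

last-bottomRow : ∀ q → last (bottomRow q) ≡ Maybe.map val (last q)
last-bottomRow []            = refl
last-bottomRow (t ∷ [])      = refl
last-bottomRow (t ∷ t' ∷ ts) = begin
  last (bottomHead t (t' ∷ ts) ∷ bottomRow (t' ∷ ts))
    ≡⟨ cong (λ m → last (bottomHead t (t' ∷ ts) ∷ m)) (bottomRow-∷ t' ts) ⟩
  last (bottomHead t' ts ∷ bottomRow ts)
    ≡⟨ cong last (bottomRow-∷ t' ts) ⟨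
  last (bottomRow (t' ∷ ts))
    ≡⟨ last-bottomRow (t' ∷ ts) ⟩
  Maybe.map val (last (t' ∷ ts)) ∎

bottomRow-embed-increasing : ∀ {w} → Linked _<_ w → bottomRow (embed w) ≡ w
bottomRow-embed-increasing []  = refl
bottomRow-embed-increasing [-] = refl
bottomRow-embed-increasing {a ∷ b ∷ w} (a<b ∷ inc) = cong₂ _∷_ head≡a rest≡
  where
  rest≡ : bottomRow (embed (b ∷ w)) ≡ b ∷ w
  rest≡ = bottomRow-embed-increasing inc
  head≡a : bottomHead (a , 1) (embed (b ∷ w)) ≡ a
  head≡a = begin
    bottomStep (ltC (a , 1) (b , 1)) a (bottomHead (b , 1) (embed w))
      ≡⟨ cong₂ (λ c h → bottomStep c a h)
               (trans (ltC-color1 a b) (ltZ-true a<b))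
               (∷-injectiveˡ (trans (sym (bottomRow-∷ (b , 1) (embed w))) rest≡)) ⟩
    bottomStep true a b
      ≡⟨ bottomStep-< a<b ⟩
    a ∎

incSuf-bottomRow-embed : ∀ w → IncSufZ (bottomRow (embed w)) ≡ IncSufZ w
incSuf-bottomRow-embed w = begin
  IncSufZ (bottomRow (embed w))   ≡⟨ incSuf-bottomRow (embed w) ⟩
  bottomRow (IncSuf (embed w))    ≡⟨ cong bottomRow (incSuf-map (λ i → i , 1) ltC-color1 w) ⟩
  bottomRow (embed (IncSufZ w))   ≡⟨ bottomRow-embed-increasing increasing ⟩
  IncSufZ w                       ∎
  where
  increasing : Linked _<_ (IncSufZ w)
  increasing = Linked.map toWitness (incSuf-ascending ltZ w)

IiZ : ℤ → List ℤ → ℕ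
IiZ i m = maybe (λ v → if ⌊ v ℤ.≤? i ⌋ then length (IncSufZ m) else 0) 0 (last m)

Ii-bottomRow : ∀ i q → Ii i q ≡ IiZ i (bottomRow q)
Ii-bottomRow i q rewrite last-bottomRow q | length-incSuf-bottomRow q with last q
... | nothing = refl
... | just t  = refl

proposition5p7 : (ψ : ColWord → List ℤ)
    → (∀ p → InM p → IsReduced (ψ p))
    → (∀ p → InM p → bottomRow (embed (ψ p)) ≡ bottomRow p)
    → LinHyp ψ
    → ∀ p → InM p
    → (∀ i → Ii i p ≡ Ii i (embed (ψ p)))
      × (IncSufZ (bottomRow p) ≡ IncSufZ (ψ p))
proposition5p7 ψ _ preserves-m _ p p∈M = same-Ii , same-incSuf
  where
  m-equal : bottomRow (embed (ψ p)) ≡ bottomRow p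
  m-equal = preserves-m p p∈M

  same-Ii : ∀ i → Ii i p ≡ Ii i (embed (ψ p))
  same-Ii i = begin
    Ii i p                          ≡⟨ Ii-bottomRow i p ⟩
    IiZ i (bottomRow p)             ≡⟨ cong (IiZ i) m-equal ⟨
    IiZ i (bottomRow (embed (ψ p))) ≡⟨ Ii-bottomRow i (embed (ψ p)) ⟨
    Ii i (embed (ψ p))              ∎

  same-incSuf : IncSufZ (bottomRow p) ≡ IncSufZ (ψ p)
  same-incSuf = trans (cong IncSufZ (sym m-equal)) (incSuf-bottomRow-embed (ψ p))
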